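{- For integers $u$ and nonnegative integers $d$, let $$\mathbf{M}^u_d(z;\theta)=\sum_{k=0}^{d}\binom{d}{k}\prod_{i=0}^{k-1}(\theta+\rho_i^2)\prod_{i=k+1}^{d}(z-i)(z+i+u-d),\qquad\rho_i=i+\tfrac12.$$ Then $\mathbf{M}^0_0=1$ and for all nonnegative integers $u,d$, $$(u+d)(z+u-d)\,\mathbf{M}^u_d=u(z+u)\,\mathbf{M}^{u-1}_d+d(z-d)\big(\theta+(z+\rho_{u-d})^2\big)\,\mathbf{M}^u_{d-1},$$ where the last term is interpreted as $0$ when $d=0$.
   Context: $z,\theta$ are indeterminates; the identities are polynomial identities in $z,\theta$. -}

module Defs where

open import Algebra.Bundles using (CommutativeRing)
open import Data.Nat as ℕ using (ℕ; zero; suc; _∸_)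
open import Data.Integer as ℤ using (ℤ; +_; -[1+_])
open import Data.Nat.Combinatorics using (_C_)

module _ {c ℓ} (R : CommutativeRing c ℓ) where
  open CommutativeRing R

  natCast : ℕ → Carrier
  natCast zero    = 0#
  natCast (suc n) = 1# + natCast n

  intCast : ℤ → Carrier
  intCast (+ n)      = natCast n
  intCast -[1+ n ]   = - natCast (suc n)

  prodN : ℕ → ℕ → (ℕ → Carrier) → Carrier
  prodN a zero    f = 1#
  prodN a (suc n) f = f a * prodN (suc a) n f

  sumN : ℕ → ℕ → (ℕ → Carrier) → Carrier
  sumN a zero    f = 0#
  sumN a (suc n) f = f a + sumN (suc a) n f

  sq : Carrier → Carrier
  sq x = x * x

  -- ρ_i = i + 1/2, where h is a given element with h * 2 = 1
  ρ : Carrier → ℤ → Carrier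
  ρ h i = intCast i + h

  M : Carrier → ℤ → ℕ → Carrier → Carrier → Carrier
  M h u d z θ =
    sumN 0 (suc d) λ k →
      natCast (d C k)
      * prodN 0 k (λ i → θ + sq (ρ h (+ i)))
      * prodN (suc k) (d ∸ k)
          (λ i → (z - natCast i) * (z + intCast ((+ i ℤ.+ u) ℤ.- + d)))

module Submission where

-- With w = u − D (D = d + 1), X i = z + i + w and Y i = z − i, the i-th factors of
-- 𝐌ᵘ_D, 𝐌ᵘ⁻¹_D and 𝐌ᵘ_d are Y i X i, Y i X (i−1) and Y i X (i+1). Telescoping these
-- products turns the k-th summand of u(z+u)𝐌ᵘ⁻¹_D into u X k · t k, where t k is the
-- k-th summand of 𝐌ᵘ_D. Splitting θ + (z + ρ_{u−D})² = (θ + ρ_j²) + (z + w − j) X (j+1)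
-- and absorbing binomials, k C(D,k) = D C(d,k−1) and (D−k) C(D,k) = D C(d,k), the
-- summands of D(z−D)(θ + (z + ρ_{u−D})²)𝐌ᵘ_d contribute k Y k · t k and
-- (D−k)(z + w − k) · t k. Summand by summand the recurrence is then the linear identity
-- (u + D)(z + w) = u X k + k Y k + (D − k)(z + w − k).

open import Defs
open import Algebra.Bundles using (CommutativeRing)
open import Algebra.Solver.Ring.AlmostCommutativeRing
  using (fromCommutativeRing; _-Raw-AlmostCommutative⟶_)
open import Data.Integer as ℤ using (ℤ; +_; -[1+_])
import Data.Integer.Properties as ℤₚ
import Data.Integer.Tactic.RingSolver as ℤ-Solver
open import Data.Maybe using (Maybe; just; nothing)
open import Data.Nat as ℕ using (ℕ; zero; suc; _∸_)
import Data.Nat.Properties as ℕₚ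
open import Data.Nat.Combinatorics
  using (_C_; nC1≡n; k>n⇒nCk≡0; nCk+nC[k+1]≡[n+1]C[k+1])
open import Data.Nat.Tactic.RingSolver using (solve-∀)
open import Data.Product using (_×_; _,_)
open import Data.Sum using (inj₁; inj₂)
open import Function using (_∘_)
open import Relation.Binary.PropositionalEquality as ≡ using (_≡_)
open import Relation.Nullary using (yes; no)

[1+k]*[1+n]C[1+k]≡[1+n]*nCk : ∀ n k → suc k ℕ.* (suc n C suc k) ≡ suc n ℕ.* (n C k)
[1+k]*[1+n]C[1+k]≡[1+n]*nCk n zero rewrite nC1≡n (suc n) = ℕₚ.*-comm 1 (suc n)
[1+k]*[1+n]C[1+k]≡[1+n]*nCk zero (suc k) = ℕₚ.*-zeroʳ (suc (suc k))
[1+k]*[1+n]C[1+k]≡[1+n]*nCk (suc n) (suc k) = begin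
  suc (suc k) ℕ.* (suc (suc n) C suc (suc k))
    ≡⟨ ≡.cong (suc (suc k) ℕ.*_) (nCk+nC[k+1]≡[n+1]C[k+1] (suc n) (suc k)) ⟨
  suc (suc k) ℕ.* (a ℕ.+ b)                           ≡⟨ expand k a b ⟩
  a ℕ.+ (suc k ℕ.* a ℕ.+ suc (suc k) ℕ.* b)
    ≡⟨ ≡.cong₂ (λ x y → a ℕ.+ (x ℕ.+ y)) ([1+k]*[1+n]C[1+k]≡[1+n]*nCk n k)
                                         ([1+k]*[1+n]C[1+k]≡[1+n]*nCk n (suc k)) ⟩
  a ℕ.+ (suc n ℕ.* (n C k) ℕ.+ suc n ℕ.* (n C suc k))
    ≡⟨ ≡.cong (a ℕ.+_) (ℕₚ.*-distribˡ-+ (suc n) (n C k) (n C suc k)) ⟨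
  a ℕ.+ suc n ℕ.* (n C k ℕ.+ n C suc k)
    ≡⟨ ≡.cong (λ x → a ℕ.+ suc n ℕ.* x) (nCk+nC[k+1]≡[n+1]C[k+1] n k) ⟩
  suc (suc n) ℕ.* a                                   ∎
  where
  open ≡.≡-Reasoning
  a b : ℕ
  a = suc n C suc k
  b = suc n C suc (suc k)
  expand : ∀ k a b → suc (suc k) ℕ.* (a ℕ.+ b) ≡ a ℕ.+ (suc k ℕ.* a ℕ.+ suc (suc k) ℕ.* b)
  expand = solve-∀

[1+n∸k]*[1+n]Ck≡[1+n]*nCk : ∀ n k → (suc n ∸ k) ℕ.* (suc n C k) ≡ suc n ℕ.* (n C k)
[1+n∸k]*[1+n]Ck≡[1+n]*nCk n zero    = ≡.refl
[1+n∸k]*[1+n]Ck≡[1+n]*nCk n (suc k) = begin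
  (suc n ∸ suc k) ℕ.* c              ≡⟨ ℕₚ.*-distribʳ-∸ c (suc n) (suc k) ⟩
  suc n ℕ.* c ∸ suc k ℕ.* c          ≡⟨ ≡.cong (_∸ suc k ℕ.* c) pascal ⟩
  suc k ℕ.* c ℕ.+ suc n ℕ.* (n C suc k) ∸ suc k ℕ.* c
                                     ≡⟨ ℕₚ.m+n∸m≡n (suc k ℕ.* c) _ ⟩
  suc n ℕ.* (n C suc k)              ∎
  where
  open ≡.≡-Reasoning
  c : ℕ
  c = suc n C suc k
  pascal : suc n ℕ.* c ≡ suc k ℕ.* c ℕ.+ suc n ℕ.* (n C suc k)
  pascal = begin
    suc n ℕ.* c  ≡⟨ ≡.cong (suc n ℕ.*_) (nCk+nC[k+1]≡[n+1]C[k+1] n k) ⟨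
    suc n ℕ.* (n C k ℕ.+ n C suc k)   ≡⟨ ℕₚ.*-distribˡ-+ (suc n) (n C k) (n C suc k) ⟩
    suc n ℕ.* (n C k) ℕ.+ suc n ℕ.* (n C suc k)
      ≡⟨ ≡.cong (ℕ._+ suc n ℕ.* (n C suc k)) ([1+k]*[1+n]C[1+k]≡[1+n]*nCk n k) ⟨
    suc k ℕ.* c ℕ.+ suc n ℕ.* (n C suc k) ∎

i-j≡[i-[1+j]]+1 : ∀ i j → i ℤ.- j ≡ i ℤ.- (+ 1 ℤ.+ j) ℤ.+ + 1
i-j≡[i-[1+j]]+1 = ℤ-Solver.solve-∀

module _ {ℓ₁ ℓ₂} (R : CommutativeRing ℓ₁ ℓ₂) where
  open CommutativeRing R
  open import Algebra.Properties.Ring ring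
    using (-0#≈0#; -‿involutive; -‿+-comm; xyx⁻¹≈y; -‿distribˡ-*; -‿distribʳ-*)
  open import Algebra.Properties.Semiring.Mult semiring using (×-homo-+; ×1-homo-*)
    renaming (_×_ to _×ᴿ_)
  open import Algebra.Properties.CommutativeSemigroup *-commutativeSemigroup using (x∙yz≈y∙xz)
  open import Relation.Binary.Reasoning.Setoid setoid

  natCast≡×1# : ∀ n → natCast R n ≡ n ×ᴿ 1#
  natCast≡×1# zero    = ≡.refl
  natCast≡×1# (suc n) = ≡.cong (_+_ 1#) (natCast≡×1# n)

  natCast-+ : ∀ m n → natCast R (m ℕ.+ n) ≈ natCast R m + natCast R n
  natCast-+ m n rewrite natCast≡×1# (m ℕ.+ n) | natCast≡×1# m | natCast≡×1# n = ×-homo-+ 1# m n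

  natCast-* : ∀ m n → natCast R (m ℕ.* n) ≈ natCast R m * natCast R n
  natCast-* m n rewrite natCast≡×1# (m ℕ.* n) | natCast≡×1# m | natCast≡×1# n = ×1-homo-* m n

  intCast-neg : ∀ i → intCast R (ℤ.- i) ≈ - intCast R i
  intCast-neg (+ zero)  = sym -0#≈0#
  intCast-neg (+ suc n) = refl
  intCast-neg -[1+ n ]  = sym (-‿involutive _)

  intCast-⊖ : ∀ m n → intCast R (m ℤ.⊖ n) ≈ natCast R m - natCast R n
  intCast-⊖ m       zero    = sym (trans (+-congˡ -0#≈0#) (+-identityʳ _))
  intCast-⊖ zero    (suc n) = sym (+-identityˡ _)
  intCast-⊖ (suc m) (suc n) = begin
    intCast R (suc m ℤ.⊖ suc n)              ≡⟨ ≡.cong (intCast R) (ℤₚ.[1+m]⊖[1+n]≡m⊖n m n) ⟩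
    intCast R (m ℤ.⊖ n)                      ≈⟨ intCast-⊖ m n ⟩
    natCast R m - natCast R n                ≈⟨ +-congʳ (xyx⁻¹≈y 1# _) ⟨
    1# + natCast R m + - 1# - natCast R n    ≈⟨ +-assoc _ _ _ ⟩
    1# + natCast R m + (- 1# - natCast R n)  ≈⟨ +-congˡ (-‿+-comm 1# _) ⟩
    (1# + natCast R m) - (1# + natCast R n)  ∎

  intCast-+ : ∀ i j → intCast R (i ℤ.+ j) ≈ intCast R i + intCast R j
  intCast-+ (+ m)    (+ n)    = natCast-+ m n
  intCast-+ (+ m)    -[1+ n ] = intCast-⊖ m (suc n)
  intCast-+ -[1+ m ] (+ n)    = trans (intCast-⊖ n (suc m)) (+-comm _ _)
  intCast-+ -[1+ m ] -[1+ n ] = begin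
    intCast R (-[1+ m ] ℤ.+ -[1+ n ])
      ≡⟨ ≡.cong (intCast R) (ℤₚ.neg-distrib-+ (+ suc m) (+ suc n)) ⟨
    intCast R (ℤ.- (+ suc m ℤ.+ + suc n))  ≈⟨ intCast-neg (+ suc m ℤ.+ + suc n) ⟩
    - natCast R (suc m ℕ.+ suc n)            ≈⟨ -‿cong (natCast-+ (suc m) (suc n)) ⟩
    - (natCast R (suc m) + natCast R (suc n)) ≈⟨ -‿+-comm _ _ ⟨
    intCast R -[1+ m ] + intCast R -[1+ n ] ∎

  intCast-pos-* : ∀ m j → intCast R (+ m ℤ.* j) ≈ natCast R m * intCast R j
  intCast-pos-* m (+ n) = begin
    intCast R (+ m ℤ.* + n)  ≡⟨ ≡.cong (intCast R) (ℤₚ.pos-* m n) ⟨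
    natCast R (m ℕ.* n)      ≈⟨ natCast-* m n ⟩
    natCast R m * natCast R n ∎
  intCast-pos-* m -[1+ n ] = begin
    intCast R (+ m ℤ.* ℤ.- + suc n)      ≡⟨ ≡.cong (intCast R) (ℤₚ.neg-distribʳ-* (+ m) (+ suc n)) ⟨
    intCast R (ℤ.- (+ m ℤ.* + suc n))    ≈⟨ intCast-neg (+ m ℤ.* + suc n) ⟩
    - intCast R (+ m ℤ.* + suc n)        ≈⟨ -‿cong (intCast-pos-* m (+ suc n)) ⟩
    - (natCast R m * natCast R (suc n))  ≈⟨ -‿distribʳ-* _ _ ⟩
    natCast R m * - natCast R (suc n)    ∎

  intCast-* : ∀ i j → intCast R (i ℤ.* j) ≈ intCast R i * intCast R j
  intCast-* (+ m)    j = intCast-pos-* m j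
  intCast-* -[1+ m ] j = begin
    intCast R (ℤ.- + suc m ℤ.* j)      ≡⟨ ≡.cong (intCast R) (ℤₚ.neg-distribˡ-* (+ suc m) j) ⟨
    intCast R (ℤ.- (+ suc m ℤ.* j))    ≈⟨ intCast-neg (+ suc m ℤ.* j) ⟩
    - intCast R (+ suc m ℤ.* j)        ≈⟨ -‿cong (intCast-pos-* (suc m) j) ⟩
    - (natCast R (suc m) * intCast R j) ≈⟨ -‿distribˡ-* _ _ ⟩
    - natCast R (suc m) * intCast R j  ∎

  -- Integer coefficients let the solver cancel terms such as x - x, which it cannot do
  -- with coefficients in the abstract carrier.
  intCast-morphism : ℤ.+-*-rawRing -Raw-AlmostCommutative⟶ fromCommutativeRing R
  intCast-morphism = record
    { ⟦_⟧    = intCast R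
    ; +-homo = intCast-+
    ; *-homo = intCast-*
    ; -‿homo = intCast-neg
    ; 0-homo = refl
    ; 1-homo = +-identityʳ 1#
    }

  intCast-≟ : ∀ i j → Maybe (intCast R i ≈ intCast R j)
  intCast-≟ i j with i ℤ.≟ j
  ... | yes ≡.refl = just refl
  ... | no _       = nothing

  open import Algebra.Solver.Ring ℤ.+-*-rawRing (fromCommutativeRing R) intCast-morphism intCast-≟
    using (solve; _:=_; _:+_; _:*_; _:-_)

  prodN-cong : ∀ a n {f g : ℕ → Carrier} → (∀ i → f i ≈ g i) → prodN R a n f ≈ prodN R a n g
  prodN-cong a zero    f≈g = refl
  prodN-cong a (suc n) f≈g = *-cong (f≈g a) (prodN-cong (suc a) n f≈g)

  prodN-shift : ∀ a n f → prodN R (suc a) n f ≡ prodN R a n (λ i → f (suc i))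
  prodN-shift a zero    f = ≡.refl
  prodN-shift a (suc n) f = ≡.cong (_*_ (f (suc a))) (prodN-shift (suc a) n f)

  prodN-snoc : ∀ a n f → prodN R a (suc n) f ≈ prodN R a n f * f (a ℕ.+ n)
  prodN-snoc a zero    f = trans (*-comm _ _) (*-congˡ (reflexive (≡.cong f (≡.sym (ℕₚ.+-identityʳ a)))))
  prodN-snoc a (suc n) f = begin
    f a * prodN R (suc a) (suc n) f             ≈⟨ *-congˡ (prodN-snoc (suc a) n f) ⟩
    f a * (prodN R (suc a) n f * f (suc a ℕ.+ n)) ≈⟨ *-assoc _ _ _ ⟨
    f a * prodN R (suc a) n f * f (suc a ℕ.+ n)   ≈⟨ *-congˡ (reflexive (≡.cong f (ℕₚ.+-suc a n))) ⟨
    f a * prodN R (suc a) n f * f (a ℕ.+ suc n)   ∎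

  prodN-telescope : ∀ a n (f g : ℕ → Carrier) →
                    g a * prodN R a n (λ i → g (suc i) * f i) ≈ g (a ℕ.+ n) * prodN R a n (λ i → g i * f i)
  prodN-telescope a zero    f g = *-congʳ (reflexive (≡.cong g (≡.sym (ℕₚ.+-identityʳ a))))
  prodN-telescope a (suc n) f g = begin
    g a * (g (suc a) * f a * prodN R (suc a) n (λ i → g (suc i) * f i))
      ≈⟨ solve 4 (λ x y z w → x :* (y :* z :* w) := x :* z :* (y :* w)) refl _ _ _ _ ⟩
    g a * f a * (g (suc a) * prodN R (suc a) n (λ i → g (suc i) * f i))
      ≈⟨ *-congˡ (prodN-telescope (suc a) n f g) ⟩
    g a * f a * (g (suc a ℕ.+ n) * prodN R (suc a) n (λ i → g i * f i))
      ≈⟨ solve 3 (λ x y z → x :* (y :* z) := y :* (x :* z)) refl _ _ _ ⟩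
    g (suc a ℕ.+ n) * (g a * f a * prodN R (suc a) n (λ i → g i * f i))
      ≈⟨ *-congʳ (reflexive (≡.cong g (ℕₚ.+-suc a n))) ⟨
    g (a ℕ.+ suc n) * (g a * f a * prodN R (suc a) n (λ i → g i * f i)) ∎

  sumN-cong : ∀ a n {f g : ℕ → Carrier} → (∀ i → i ℕ.< a ℕ.+ n → f i ≈ g i) →
              sumN R a n f ≈ sumN R a n g
  sumN-cong a zero    f≈g = refl
  sumN-cong a (suc n) f≈g = +-cong (f≈g a (ℕₚ.m<m+n a (ℕ.s≤s ℕ.z≤n)))
    (sumN-cong (suc a) n (λ i i<1+a+n → f≈g i (≡.subst (i ℕ.<_) (≡.sym (ℕₚ.+-suc a n)) i<1+a+n)))

  sumN-shift : ∀ a n f → sumN R (suc a) n f ≡ sumN R a n (λ i → f (suc i))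
  sumN-shift a zero    f = ≡.refl
  sumN-shift a (suc n) f = ≡.cong (_+_ (f (suc a))) (sumN-shift (suc a) n f)

  sumN-snoc : ∀ a n f → sumN R a (suc n) f ≈ sumN R a n f + f (a ℕ.+ n)
  sumN-snoc a zero    f = trans (+-comm _ _) (+-congˡ (reflexive (≡.cong f (≡.sym (ℕₚ.+-identityʳ a)))))
  sumN-snoc a (suc n) f = begin
    f a + sumN R (suc a) (suc n) f              ≈⟨ +-congˡ (sumN-snoc (suc a) n f) ⟩
    f a + (sumN R (suc a) n f + f (suc a ℕ.+ n)) ≈⟨ +-assoc _ _ _ ⟨
    f a + sumN R (suc a) n f + f (suc a ℕ.+ n)   ≈⟨ +-congˡ (reflexive (≡.cong f (ℕₚ.+-suc a n))) ⟨
    f a + sumN R (suc a) n f + f (a ℕ.+ suc n)   ∎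

  *-distribˡ-sumN : ∀ x a n f → x * sumN R a n f ≈ sumN R a n (λ i → x * f i)
  *-distribˡ-sumN x a zero    f = zeroʳ x
  *-distribˡ-sumN x a (suc n) f = trans (distribˡ _ _ _) (+-congˡ (*-distribˡ-sumN x (suc a) n f))

  sumN-distrib-+ : ∀ a n f g → sumN R a n (λ i → f i + g i) ≈ sumN R a n f + sumN R a n g
  sumN-distrib-+ a zero    f g = sym (+-identityˡ 0#)
  sumN-distrib-+ a (suc n) f g = trans (+-congˡ (sumN-distrib-+ (suc a) n f g))
    (solve 4 (λ x y z w → x :+ y :+ (z :+ w) := x :+ z :+ (y :+ w)) refl _ _ _ _)

  module Factors (z : Carrier) where

    Y : ℕ → Carrier
    Y i = z - natCast R i

    X : Carrier → ℕ → Carrier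
    X c i = z + (natCast R i + c)

    -- factor (u − d) i = (z − i)(z + i + u − d) is the i-th factor of 𝐌ᵘ_d.
    factor : Carrier → ℕ → Carrier
    factor c i = Y i * X c i

    X-pred-suc : ∀ c i → X (c - 1#) (suc i) ≈ X c i
    X-pred-suc c i = +-congˡ (solve 3 (λ o n c → o :+ n :+ (c :- o) := n :+ c) refl 1# (natCast R i) c)

    X-suc : ∀ c i → X (c + 1#) i ≈ X c (suc i)
    X-suc c i = +-congˡ (solve 3 (λ o n c → n :+ (c :+ o) := o :+ n :+ c) refl 1# (natCast R i) c)

    factor-X-telescope : ∀ c k m → X c k * prodN R (suc k) m (factor c)
                                   ≈ X c (k ℕ.+ m) * prodN R (suc k) m (factor (c - 1#))
    factor-X-telescope c k m = begin
      X c k * prodN R (suc k) m (factor c)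
        ≈⟨ *-cong (sym (X-pred-suc c k))
                  (prodN-cong (suc k) m λ i → trans (*-comm _ _) (*-congʳ (sym (X-pred-suc c i)))) ⟩
      X′ (suc k) * prodN R (suc k) m (λ i → X′ (suc i) * Y i)
        ≈⟨ prodN-telescope (suc k) m Y X′ ⟩
      X′ (suc (k ℕ.+ m)) * prodN R (suc k) m (λ i → X′ i * Y i)
        ≈⟨ *-cong (X-pred-suc c (k ℕ.+ m)) (prodN-cong (suc k) m λ i → *-comm _ _) ⟩
      X c (k ℕ.+ m) * prodN R (suc k) m (factor (c - 1#)) ∎
      where
      X′ : ℕ → Carrier
      X′ = X (c - 1#)

    factor-Y-telescope : ∀ c k m → Y (k ℕ.+ m) * prodN R k m (factor (c + 1#))
                                   ≈ Y k * prodN R (suc k) m (factor c)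
    factor-Y-telescope c k m = begin
      Y (k ℕ.+ m) * prodN R k m (factor (c + 1#))
        ≈⟨ *-congˡ (prodN-cong k m λ i → *-congˡ (X-suc c i)) ⟩
      Y (k ℕ.+ m) * prodN R k m (λ i → Y i * X c (suc i))
        ≈⟨ prodN-telescope k m (λ i → X c (suc i)) Y ⟨
      Y k * prodN R k m (λ i → factor c (suc i))
        ≡⟨ ≡.cong (Y k *_) (prodN-shift k m (factor c)) ⟨
      Y k * prodN R (suc k) m (factor c) ∎

  module _ (h z θ : Carrier) where
    open Factors z

    θρ² : ℕ → Carrier
    θρ² i = θ + sq R (ρ R h (+ i))

    A : ℕ → Carrier
    A k = prodN R 0 k θρ²

    summand : Carrier → ℕ → ℕ → Carrier
    summand c n k = natCast R (n C k) * A k * prodN R (suc k) (n ∸ k) (factor c)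

    T : Carrier → ℕ → Carrier
    T c n = sumN R 0 (suc n) (summand c n)

    M≈T : ∀ u d {c} → intCast R (u ℤ.- + d) ≈ c → M R h u d z θ ≈ T c d
    M≈T u d {c} u-d≈c =
      sumN-cong 0 (suc d) λ k _ → *-congˡ (prodN-cong (suc k) (d ∸ k) λ i → *-congˡ (+-congˡ (shift i)))
      where
      shift : ∀ i → intCast R ((+ i ℤ.+ u) ℤ.- + d) ≈ natCast R i + c
      shift i = begin
        intCast R ((+ i ℤ.+ u) ℤ.- + d)      ≡⟨ ≡.cong (intCast R) (ℤₚ.+-assoc (+ i) u (ℤ.- + d)) ⟩
        intCast R (+ i ℤ.+ (u ℤ.- + d))      ≈⟨ intCast-+ (+ i) (u ℤ.- + d) ⟩
        natCast R i + intCast R (u ℤ.- + d)  ≈⟨ +-congˡ u-d≈c ⟩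
        natCast R i + c                      ∎

    module Recurrence (h*2≈1 : h * (1# + 1#) ≈ 1#) (d : ℕ) (w : Carrier) where

      D : ℕ
      D = suc d

      Z : ℕ → Carrier
      Z k = z + (w - natCast R k)

      E : Carrier
      E = θ + sq R (z + (w + h))

      φ ψ φ′ : ℕ → Carrier
      φ j = θρ² j * summand (w + 1#) d j
      ψ j = Z j * X w (suc j) * summand (w + 1#) d j
      φ′ zero    = 0#
      φ′ (suc j) = φ j

      -- (z + w + h)² − (j + h)² = (z + w − j)(z + w + j + 2h), and 2h = 1.
      E≈θρ²+ZX : ∀ j → E ≈ θρ² j + Z j * X w (suc j)
      E≈θρ²+ZX j = begin
        θ + (z + (w + h)) * (z + (w + h))
          ≈⟨ solve 6 (λ θ z w j h o →
               θ :+ (z :+ (w :+ h)) :* (z :+ (w :+ h))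
               := θ :+ (j :+ h) :* (j :+ h) :+ (z :+ (w :- j)) :* (z :+ (o :+ j :+ w))
                  :+ (z :+ (w :- j)) :* (h :+ h :- o))
             refl θ z w (natCast R j) h 1# ⟩
        θρ² j + Z j * X w (suc j) + Z j * (h + h - 1#)
          ≈⟨ +-congˡ (*-congˡ (trans (+-congʳ h+h≈1) (-‿inverseʳ 1#))) ⟩
        θρ² j + Z j * X w (suc j) + Z j * 0#
          ≈⟨ trans (+-congˡ (zeroʳ _)) (+-identityʳ _) ⟩
        θρ² j + Z j * X w (suc j) ∎
        where
        h+h≈1 : h + h ≈ 1#
        h+h≈1 = trans (sym (+-cong (*-identityʳ h) (*-identityʳ h))) (trans (sym (distribˡ h 1# 1#)) h*2≈1)

      ψ-top : ψ D ≈ 0#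
      ψ-top = begin
        Z D * X w (suc D) * (natCast R (d C D) * A D * Π)
          ≡⟨ ≡.cong (λ n → Z D * X w (suc D) * (natCast R n * A D * Π)) (k>n⇒nCk≡0 (ℕₚ.n<1+n d)) ⟩
        Z D * X w (suc D) * (0# * A D * Π) ≈⟨ *-congˡ (trans (*-congʳ (zeroˡ _)) (zeroˡ _)) ⟩
        Z D * X w (suc D) * 0#              ≈⟨ zeroʳ _ ⟩
        0#                                   ∎
        where
        Π : Carrier
        Π = prodN R (suc D) (d ∸ D) (factor (w + 1#))

      scalar-split : ∀ k → k ℕ.≤ D →
        (natCast R D + w + natCast R D) * (z + w)
          ≈ (natCast R D + w) * X w k + natCast R k * Y k + natCast R (D ∸ k) * Z k
      scalar-split k k≤D = begin
        (natCast R D + w + natCast R D) * (z + w)   ≈⟨ *-congʳ (+-cong (+-congʳ D≈k+m) D≈k+m) ⟩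
        (k′ + m′ + w + (k′ + m′)) * (z + w)
          ≈⟨ solve 4 (λ z w k m → (k :+ m :+ w :+ (k :+ m)) :* (z :+ w)
                := (k :+ m :+ w) :* (z :+ (k :+ w)) :+ k :* (z :- k) :+ m :* (z :+ (w :- k)))
             refl z w k′ m′ ⟩
        (k′ + m′ + w) * X w k + k′ * Y k + m′ * Z k ≈⟨ +-congʳ (+-congʳ (*-congʳ (+-congʳ D≈k+m))) ⟨
        (natCast R D + w) * X w k + k′ * Y k + m′ * Z k ∎
        where
        k′ m′ : Carrier
        k′ = natCast R k
        m′ = natCast R (D ∸ k)
        D≈k+m : natCast R D ≈ k′ + m′
        D≈k+m = trans (reflexive (≡.cong (natCast R) (≡.sym (ℕₚ.m+[n∸m]≡n k≤D)))) (natCast-+ k (D ∸ k))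

      Y-telescoped : ∀ k → k ℕ.≤ d → Y D * prodN R (suc k) (d ∸ k) (factor (w + 1#))
                                   ≈ Y (suc k) * prodN R (suc (suc k)) (d ∸ k) (factor w)
      Y-telescoped k k≤d = trans
        (*-congʳ (reflexive (≡.cong (Y ∘ suc) (≡.sym (ℕₚ.m+[n∸m]≡n k≤d)))))
        (factor-Y-telescope w (suc k) (d ∸ k))

      q-contribution : ∀ k → k ℕ.≤ D →
        (natCast R D + w) * X w D * summand (w - 1#) D k ≈ (natCast R D + w) * X w k * summand w D k
      q-contribution k k≤D = begin
        a * X w D * (c * Q)    ≈⟨ *-assoc _ _ _ ⟩
        a * (X w D * (c * Q))  ≈⟨ *-congˡ (x∙yz≈y∙xz _ _ _) ⟩
        a * (c * (X w D * Q))  ≈⟨ *-congˡ (*-congˡ telescoped) ⟨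
        a * (c * (X w k * P))  ≈⟨ *-congˡ (x∙yz≈y∙xz _ _ _) ⟨
        a * (X w k * (c * P))  ≈⟨ *-assoc _ _ _ ⟨
        a * X w k * (c * P)    ∎
        where
        a c P Q : Carrier
        a = natCast R D + w
        c = natCast R (D C k) * A k
        P = prodN R (suc k) (D ∸ k) (factor w)
        Q = prodN R (suc k) (D ∸ k) (factor (w - 1#))
        telescoped : X w k * P ≈ X w D * Q
        telescoped = trans (factor-X-telescope w k (D ∸ k))
                           (reflexive (≡.cong (λ n → X w n * Q) (ℕₚ.m+[n∸m]≡n k≤D)))

      φ-contribution : ∀ k → k ℕ.≤ D → natCast R D * Y D * φ′ k ≈ natCast R k * Y k * summand w D k
      φ-contribution zero    _     = trans (zeroʳ _) (sym (trans (*-congʳ (zeroˡ _)) (zeroˡ _)))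
      φ-contribution (suc j) 1+j≤D = begin
        natCast R D * Y D * (θρ² j * (natCast R (d C j) * A j * R′))
          ≈⟨ solve 6 (λ n y t c a r → n :* y :* (t :* (c :* a :* r)) := n :* c :* (a :* t) :* (y :* r))
               refl _ _ _ _ _ _ ⟩
        natCast R D * natCast R (d C j) * (A j * θρ² j) * (Y D * R′)
          ≈⟨ *-cong (*-cong absorbed (sym (prodN-snoc 0 j θρ²))) (Y-telescoped j (ℕ.s≤s⁻¹ 1+j≤D)) ⟩
        natCast R (suc j) * natCast R (D C suc j) * A (suc j) * (Y (suc j) * P)
          ≈⟨ solve 5 (λ n c a y p → n :* c :* a :* (y :* p) := n :* y :* (c :* a :* p)) refl _ _ _ _ _ ⟩
        natCast R (suc j) * Y (suc j) * summand w D (suc j) ∎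
        where
        R′ P : Carrier
        R′ = prodN R (suc j) (d ∸ j) (factor (w + 1#))
        P = prodN R (suc (suc j)) (d ∸ j) (factor w)
        absorbed : natCast R D * natCast R (d C j) ≈ natCast R (suc j) * natCast R (D C suc j)
        absorbed = begin
          natCast R D * natCast R (d C j)       ≈⟨ natCast-* D (d C j) ⟨
          natCast R (D ℕ.* (d C j))             ≡⟨ ≡.cong (natCast R) ([1+k]*[1+n]C[1+k]≡[1+n]*nCk d j) ⟨
          natCast R (suc j ℕ.* (D C suc j))     ≈⟨ natCast-* (suc j) (D C suc j) ⟩
          natCast R (suc j) * natCast R (D C suc j) ∎

      ψ-contribution : ∀ k → k ℕ.≤ D → natCast R D * Y D * ψ k ≈ natCast R (D ∸ k) * Z k * summand w D k
      ψ-contribution k k≤D with ℕₚ.m≤n⇒m<n∨m≡n k≤D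
      ... | inj₂ ≡.refl = begin
        natCast R D * Y D * ψ D                   ≈⟨ trans (*-congˡ ψ-top) (zeroʳ _) ⟩
        0#                                        ≈⟨ trans (*-congʳ (zeroˡ _)) (zeroˡ _) ⟨
        0# * Z D * summand w D D                  ≈⟨ *-congʳ (*-congʳ (reflexive (≡.cong (natCast R) (ℕₚ.n∸n≡0 D)))) ⟨
        natCast R (D ∸ D) * Z D * summand w D D   ∎
      ... | inj₁ (ℕ.s≤s k≤d) = begin
        natCast R D * Y D * (Z k * X w (suc k) * (natCast R (d C k) * A k * R′))
          ≈⟨ solve 7 (λ n y z x c a r → n :* y :* (z :* x :* (c :* a :* r)) := n :* c :* z :* a :* (x :* (y :* r)))
               refl _ _ _ _ _ _ _ ⟩
        natCast R D * natCast R (d C k) * Z k * A k * (X w (suc k) * (Y D * R′))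
          ≈⟨ *-cong (*-congʳ (*-congʳ absorbed)) (*-congˡ (Y-telescoped k k≤d)) ⟩
        natCast R (D ∸ k) * natCast R (D C k) * Z k * A k * (X w (suc k) * (Y (suc k) * P))
          ≈⟨ solve 7 (λ m c z a x y p → m :* c :* z :* a :* (x :* (y :* p)) := m :* z :* (c :* a :* (y :* x :* p)))
               refl _ _ _ _ _ _ _ ⟩
        natCast R (D ∸ k) * Z k * (natCast R (D C k) * A k * prodN R (suc k) (suc (d ∸ k)) (factor w))
          ≡⟨ ≡.cong (λ n → natCast R (D ∸ k) * Z k * (natCast R (D C k) * A k * prodN R (suc k) n (factor w)))
                    (ℕₚ.+-∸-assoc 1 k≤d) ⟨
        natCast R (D ∸ k) * Z k * summand w D k ∎
        where
        R′ P : Carrier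
        R′ = prodN R (suc k) (d ∸ k) (factor (w + 1#))
        P = prodN R (suc (suc k)) (d ∸ k) (factor w)
        absorbed : natCast R D * natCast R (d C k) ≈ natCast R (D ∸ k) * natCast R (D C k)
        absorbed = begin
          natCast R D * natCast R (d C k)          ≈⟨ natCast-* D (d C k) ⟨
          natCast R (D ℕ.* (d C k))                ≡⟨ ≡.cong (natCast R) ([1+n∸k]*[1+n]Ck≡[1+n]*nCk d k) ⟨
          natCast R ((D ∸ k) ℕ.* (D C k))          ≈⟨ natCast-* (D ∸ k) (D C k) ⟩
          natCast R (D ∸ k) * natCast R (D C k)    ∎

      summand-identity : ∀ k → k ℕ.≤ D →
        (natCast R D + w + natCast R D) * (z + w) * summand w D k
          ≈ (natCast R D + w) * X w D * summand (w - 1#) D k + natCast R D * Y D * (φ′ k + ψ k)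
      summand-identity k k≤D = begin
        (natCast R D + w + natCast R D) * (z + w) * t
          ≈⟨ *-congʳ (scalar-split k k≤D) ⟩
        ((natCast R D + w) * X w k + natCast R k * Y k + natCast R (D ∸ k) * Z k) * t
          ≈⟨ trans (distribʳ _ _ _) (+-congʳ (distribʳ _ _ _)) ⟩
        (natCast R D + w) * X w k * t + natCast R k * Y k * t + natCast R (D ∸ k) * Z k * t
          ≈⟨ +-cong (+-cong (q-contribution k k≤D) (φ-contribution k k≤D)) (ψ-contribution k k≤D) ⟨
        (natCast R D + w) * X w D * summand (w - 1#) D k + γ * φ′ k + γ * ψ k
          ≈⟨ trans (+-assoc _ _ _) (+-congˡ (sym (distribˡ _ _ _))) ⟩
        (natCast R D + w) * X w D * summand (w - 1#) D k + γ * (φ′ k + ψ k) ∎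
        where
        t γ : Carrier
        t = summand w D k
        γ = natCast R D * Y D

      regroup : sumN R 0 (suc D) (λ k → φ′ k + ψ k) ≈ sumN R 0 D (λ j → φ j + ψ j)
      regroup = begin
        sumN R 0 (suc D) (λ k → φ′ k + ψ k)       ≈⟨ sumN-distrib-+ 0 (suc D) φ′ ψ ⟩
        sumN R 0 (suc D) φ′ + sumN R 0 (suc D) ψ  ≈⟨ +-cong φ′-sum ψ-sum ⟩
        sumN R 0 D φ + sumN R 0 D ψ               ≈⟨ sumN-distrib-+ 0 D φ ψ ⟨
        sumN R 0 D (λ j → φ j + ψ j)              ∎
        where
        φ′-sum : sumN R 0 (suc D) φ′ ≈ sumN R 0 D φ
        φ′-sum = trans (+-identityˡ _) (reflexive (sumN-shift 0 D φ′))
        ψ-sum : sumN R 0 (suc D) ψ ≈ sumN R 0 D ψ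
        ψ-sum = trans (sumN-snoc 0 D ψ) (trans (+-congˡ ψ-top) (+-identityʳ _))

      T-recurrence : (natCast R D + w + natCast R D) * (z + w) * T w D
                     ≈ (natCast R D + w) * X w D * T (w - 1#) D + natCast R D * Y D * E * T (w + 1#) d
      T-recurrence = begin
        α * T w D
          ≈⟨ *-distribˡ-sumN α 0 (suc D) (summand w D) ⟩
        sumN R 0 (suc D) (λ k → α * summand w D k)
          ≈⟨ sumN-cong 0 (suc D) (λ k k<1+D → summand-identity k (ℕ.s≤s⁻¹ k<1+D)) ⟩
        sumN R 0 (suc D) (λ k → β * summand (w - 1#) D k + γ * (φ′ k + ψ k))
          ≈⟨ sumN-distrib-+ 0 (suc D) (λ k → β * summand (w - 1#) D k) (λ k → γ * (φ′ k + ψ k)) ⟩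
        sumN R 0 (suc D) (λ k → β * summand (w - 1#) D k) + sumN R 0 (suc D) (λ k → γ * (φ′ k + ψ k))
          ≈⟨ +-cong (*-distribˡ-sumN β 0 (suc D) (summand (w - 1#) D))
                    (*-distribˡ-sumN γ 0 (suc D) (λ k → φ′ k + ψ k)) ⟨
        β * T (w - 1#) D + γ * sumN R 0 (suc D) (λ k → φ′ k + ψ k)
          ≈⟨ +-congˡ (*-congˡ regroup) ⟩
        β * T (w - 1#) D + γ * sumN R 0 D (λ j → φ j + ψ j)
          ≈⟨ +-congˡ (*-congˡ (sumN-cong 0 D λ j _ → trans (*-congʳ (E≈θρ²+ZX j)) (distribʳ _ _ _))) ⟨
        β * T (w - 1#) D + γ * sumN R 0 D (λ j → E * summand (w + 1#) d j)
          ≈⟨ +-congˡ (trans (*-assoc _ _ _) (*-congˡ (*-distribˡ-sumN E 0 D (summand (w + 1#) d)))) ⟨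
        β * T (w - 1#) D + γ * E * T (w + 1#) d ∎
        where
        α β γ : Carrier
        α = (natCast R D + w + natCast R D) * (z + w)
        β = (natCast R D + w) * X w D
        γ = natCast R D * Y D

    M-recurrence : h * (1# + 1#) ≈ 1# → ∀ u d →
      natCast R (u ℕ.+ suc d) * (z + intCast R (+ u ℤ.- + suc d)) * M R h (+ u) (suc d) z θ
        ≈ natCast R u * (z + natCast R u) * M R h (+ u ℤ.- + 1) (suc d) z θ
          + natCast R (suc d) * (z - natCast R (suc d))
            * (θ + sq R (z + ρ R h (+ u ℤ.- + suc d))) * M R h (+ u) d z θ
    M-recurrence h*2≈1 u d = begin
      natCast R (u ℕ.+ D) * (z + w) * M R h (+ u) D z θ
        ≈⟨ *-cong (*-congʳ (trans (natCast-+ u D) (+-congʳ u≈D+w))) (M≈T (+ u) D refl) ⟩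
      (natCast R D + w + natCast R D) * (z + w) * T w D
        ≈⟨ T-recurrence ⟩
      (natCast R D + w) * X w D * T (w - 1#) D + natCast R D * Y D * E * T (w + 1#) d
        ≈⟨ +-cong (*-cong (*-cong u≈D+w (+-congˡ u≈D+w)) (M≈T (+ u ℤ.- + 1) D lowered))
                  (*-congˡ (M≈T (+ u) d raised)) ⟨
      natCast R u * (z + natCast R u) * M R h (+ u ℤ.- + 1) D z θ
        + natCast R D * Y D * E * M R h (+ u) d z θ ∎
      where
      w : Carrier
      w = intCast R (+ u ℤ.- + suc d)
      open Recurrence h*2≈1 d w
      u≈D+w : natCast R u ≈ natCast R D + w
      u≈D+w = begin
        natCast R u                              ≈⟨ solve 2 (λ u n → u := n :+ (u :- n)) refl _ _ ⟩
        natCast R D + (natCast R u - natCast R D) ≈⟨ +-congˡ (intCast-⊖ u D) ⟨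
        natCast R D + w                          ∎
      lowered : intCast R ((+ u ℤ.- + 1) ℤ.- + D) ≈ w - 1#
      lowered = begin
        intCast R ((+ u ℤ.- + 1) ℤ.- + D)
          ≡⟨ ≡.cong (intCast R) (xy∙z≈xz∙y (+ u) (ℤ.- + 1) (ℤ.- + D)) ⟩
        intCast R ((+ u ℤ.- + D) ℤ.- + 1)  ≈⟨ intCast-+ (+ u ℤ.- + D) (ℤ.- + 1) ⟩
        w + - (1# + 0#)                     ≈⟨ +-congˡ (-‿cong (+-identityʳ 1#)) ⟩
        w - 1#                              ∎
        where
        open import Algebra.Properties.CommutativeSemigroup ℤₚ.+-commutativeSemigroup
          using (xy∙z≈xz∙y)
      raised : intCast R (+ u ℤ.- + d) ≈ w + 1#
      raised = begin
        intCast R (+ u ℤ.- + d)             ≡⟨ ≡.cong (intCast R) (i-j≡[i-[1+j]]+1 (+ u) (+ d)) ⟩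
        intCast R ((+ u ℤ.- + D) ℤ.+ + 1)   ≈⟨ intCast-+ (+ u ℤ.- + D) (+ 1) ⟩
        w + (1# + 0#)                       ≈⟨ +-congˡ (+-identityʳ 1#) ⟩
        w + 1#                              ∎

proposition4p4 : ∀ {c ℓ} (R : CommutativeRing c ℓ) → let open CommutativeRing R in
    (h : Carrier) → h * (1# + 1#) ≈ 1# → (z θ : Carrier) →
      (M R h (+ 0) 0 z θ ≈ 1#)
      × (∀ (u : ℕ) →
           natCast R (u ℕ.+ 0) * (z + intCast R (+ u ℤ.- + 0)) * M R h (+ u) 0 z θ
             ≈ natCast R u * (z + natCast R u) * M R h (+ u ℤ.- + 1) 0 z θ + 0#)
      × (∀ (u d : ℕ) →
           natCast R (u ℕ.+ suc d) * (z + intCast R (+ u ℤ.- + suc d)) * M R h (+ u) (suc d) z θ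
             ≈ natCast R u * (z + natCast R u) * M R h (+ u ℤ.- + 1) (suc d) z θ
               + natCast R (suc d) * (z - natCast R (suc d))
                 * (θ + sq R (z + ρ R h (+ u ℤ.- + suc d))) * M R h (+ u) d z θ)
proposition4p4 R h h*2≈1 z θ = M⁰₀≈1 , M-degree-zero , M-recurrence R h z θ h*2≈1
  where
  open CommutativeRing R
  M⁰₀≈1 : M R h (+ 0) 0 z θ ≈ 1#
  M⁰₀≈1 = trans (+-identityʳ _) (trans (*-identityʳ _) (trans (*-identityʳ _) (+-identityʳ 1#)))
  M-degree-zero : ∀ u → natCast R (u ℕ.+ 0) * (z + intCast R (+ u ℤ.- + 0)) * M R h (+ u) 0 z θ
                        ≈ natCast R u * (z + natCast R u) * M R h (+ u ℤ.- + 1) 0 z θ + 0#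
  -- 𝐌ᵘ₀ and 𝐌ᵘ⁻¹₀ are the same term: their products are empty.
  M-degree-zero u = trans (*-congʳ (*-cong u+0≈u (+-congˡ u+0≈u))) (sym (+-identityʳ _))
    where
    u+0≈u : natCast R (u ℕ.+ 0) ≈ natCast R u
    u+0≈u = reflexive (≡.cong (natCast R) (ℕₚ.+-identityʳ u))
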